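{- For every integer $n \ge 3$, the generalized Petersen graph $\mathrm{GP}(n,1)$ is Fibonacci cordial.
   Context: The Fibonacci numbers are defined by $F_0=0$, $F_1=F_2=1$, $F_n=F_{n-1}+F_{n-2}$. For a graph $G$ with $N$ vertices, a Fibonacci cordial labeling is an injective function $f:V(G)\to\{F_0,F_1,\dots,F_N\}$ (labels $F_i$ with distinct indices are regarded as distinct labels) such that the induced edge labeling $f^*:E(G)\to\{0,1\}$, $f^*(uv)=(f(u)+f(v)) \bmod 2$, satisfies $|\varepsilon_0-\varepsilon_1|\le 1$, where $\varepsilon_i$ is the number of edges labeled $i$. A graph admitting such a labeling is called Fibonacci cordial. For $n\ge 3$, $\mathrm{GP}(n,1)$ has vertex set $\{u_i,v_i:1\le i\le n\}$ and edge set $\{u_iu_{i+1},\ u_iv_i,\ v_iv_{i+1}:1\le i\le n\}$, indices taken modulo $n$ (i.e. the prism $C_n\square K_2$). -}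

module Defs where

open import Data.Nat using (ℕ; zero; suc; _+_; _%_; _∸_)
open import Data.Nat.DivMod using (m%n<n)
open import Data.Fin using (Fin; toℕ; fromℕ<; _↑ˡ_; _↑ʳ_)
open import Data.Product using (_×_; _,_)
open import Data.List using (List; []; _∷_; _++_; length; filter; concatMap; allFin)
open import Relation.Binary.PropositionalEquality using (_≡_)
open import Function.Definitions using (Injective)
open import Data.Nat using (_≟_)

fib : ℕ → ℕ
fib zero = 0
fib (suc zero) = 1
fib (suc (suc n)) = fib (suc n) + fib n

-- A finite graph: N = order vertices, represented as Fin N,
-- together with its list of edges (each edge listed once).
record Graph : Set where
  field
    order : ℕ
    edges : List (Fin order × Fin order)
open Graph public

next : {n : ℕ} → Fin n → Fin n
next {suc n} i = fromℕ< (m%n<n (suc (toℕ i)) (suc n))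

-- GP(n,1): vertices u_i = i ↑ˡ n (indices 0..n-1), v_i = n ↑ʳ i (indices n..2n-1)
-- edges u_i u_{i+1}, u_i v_i, v_i v_{i+1} for every i (indices mod n).
GP1 : ℕ → Graph
GP1 n = record
  { order = n + n
  ; edges = concatMap edgesAt (allFin n)
  }
  where
  u v : Fin n → Fin (n + n)
  u i = i ↑ˡ n
  v i = n ↑ʳ i
  edgesAt : Fin n → List (Fin (n + n) × Fin (n + n))
  edgesAt i = (u i , u (next i)) ∷ (u i , v i) ∷ (v i , v (next i)) ∷ []

-- A labeling assigns to each vertex an index k ∈ {0,…,N}, the label being F_k.
-- Labels with distinct indices are distinct, so injectivity is on indices.
Labeling : Graph → Set
Labeling G = Fin (order G) → Fin (suc (order G))

edgeLabel : (G : Graph) → Labeling G → Fin (order G) × Fin (order G) → ℕ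
edgeLabel G f (a , b) = (fib (toℕ (f a)) + fib (toℕ (f b))) % 2

ε : (G : Graph) → Labeling G → ℕ → ℕ
ε G f i = length (filter (λ e → edgeLabel G f e ≟ i) (edges G))

Balanced : ℕ → ℕ → Set
Balanced a b = (a ∸ b ≤ 1) × (b ∸ a ≤ 1)
  where open Data.Nat using (_≤_)

FibonacciCordialLabeling : (G : Graph) → Labeling G → Set
FibonacciCordialLabeling G f = Injective _≡_ _≡_ f × Balanced (ε G f 0) (ε G f 1)

open import Data.Product using (Σ)

FibonacciCordial : Graph → Set
FibonacciCordial G = Σ (Labeling G) (FibonacciCordialLabeling G)

{-# OPTIONS --safe #-}
module Submission where

-- F_k is even exactly when 3 divides k, so an edge is labelled 1 iff exactly one of its endpoints
-- has an index divisible by 3.  Label u_j and v_j by F_{σ(2j)} and F_{σ(2j+1)}, where σ permutes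
-- each block of 24 consecutive indices by a fixed product of transpositions and never raises the
-- index 2j or 2j+1 above 2j+2, so the indices stay within 0..2n.  As 3 divides 24, the edge labels
-- repeat every 12 positions i along the prism: the 36 edges u_i u_{i+1}, u_i v_i, v_i v_{i+1} of 12
-- consecutive positions carry 18 labels of each kind, and the closing position depends only on
-- n mod 12.  So ε₀ and ε₁ both grow by 18 when n grows by 12, and balance only has to be checked
-- for 3 ≤ n < 15.

open import Defs
open import Data.Nat
  using (ℕ; zero; suc; _+_; _*_; _∸_; _%_; _/_; _≤_; _<_; _≥_; _≟_; _≡ᵇ_; _≤?_; z≤n; s≤s;
         NonZero)
open import Data.Nat.Properties
  using (+-assoc; +-comm; +-suc; +-identityʳ; *-comm; *-cancelʳ-≡; +-monoʳ-≤; *-monoˡ-≤; ≤-trans;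
         ≤-reflexive; suc-injective; even≢odd; [m+n]∸[m+o]≡n∸o; allUpTo?)
open import Data.Nat.DivMod
  using (m≡m%n+[m/n]*n; m%n<n; %-distribˡ-+; [m+kn]%n≡m%n; [m+n]%n≡m%n; +-distrib-/-∣ˡ; n/n≡1;
         m<n⇒m%n≡m; n%n≡0)
open import Data.Nat.Divisibility using (∣-refl)
open import Data.Nat.Tactic.RingSolver using (solve-∀)
open import Data.Fin using (Fin; toℕ; fromℕ<; splitAt; join; _↑ˡ_; _↑ʳ_)
open import Data.Fin.Properties
  using (toℕ-fromℕ<; toℕ-injective; toℕ<n; splitAt-↑ˡ; splitAt-↑ʳ; join-splitAt)
open import Data.List
  using (List; []; _∷_; _++_; [_]; length; filter; map; concat; concatMap; applyUpTo; tabulate; allFin)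
open import Data.List.Properties
  using (length-++; filter-++; map-concatMap; concatMap-cong; map-tabulate; applyUpTo-∷ʳ; concat-++;
         ++-assoc; ++-identityʳ)
open import Data.Product using (_×_; _,_; proj₁; proj₂)
open import Data.Empty using (⊥-elim)
open import Data.Sum using (_⊎_; inj₁; inj₂)
open import Function using (_∘_; id)
open import Function.Definitions using (Injective)
open import Relation.Nullary.Decidable using (Dec; does; from-yes; _×-dec_)
open import Data.Bool using (true; false; if_then_else_)
open import Relation.Binary.PropositionalEquality
  using (_≡_; _≢_; refl; sym; trans; cong; cong₂; subst; subst₂; module ≡-Reasoning)

open ≡-Reasoning

-- Computing F_k mod 2 from k mod 3 keeps the finite checks below cheap.
fibParity : ℕ → ℕ
fibParity 0 = 0
fibParity 1 = 1
fibParity 2 = 1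
fibParity (suc (suc (suc k))) = fibParity k

fib-+3 : ∀ k → fib (3 + k) ≡ fib k + fib (suc k) * 2
fib-+3 k = rearrange (fib (suc k)) (fib k)
  where
  rearrange : ∀ x y → (x + y) + x ≡ y + x * 2
  rearrange = solve-∀

fib%2≡fibParity : ∀ k → fib k % 2 ≡ fibParity k
fib%2≡fibParity 0 = refl
fib%2≡fibParity 1 = refl
fib%2≡fibParity 2 = refl
fib%2≡fibParity (suc (suc (suc k))) = begin
  fib (3 + k) % 2                  ≡⟨ cong (_% 2) (fib-+3 k) ⟩
  (fib k + fib (suc k) * 2) % 2    ≡⟨ [m+kn]%n≡m%n (fib k) (fib (suc k)) 2 ⟩
  fib k % 2                        ≡⟨ fib%2≡fibParity k ⟩
  fibParity k                      ∎

infixl 6 _⊕_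
_⊕_ : ℕ → ℕ → ℕ
a ⊕ b = (a + b) % 2

fib+fib%2 : ∀ a b → (fib a + fib b) % 2 ≡ fibParity a ⊕ fibParity b
fib+fib%2 a b = begin
  (fib a + fib b) % 2              ≡⟨ %-distribˡ-+ (fib a) (fib b) 2 ⟩
  (fib a % 2 + fib b % 2) % 2      ≡⟨ cong₂ _⊕_ (fib%2≡fibParity a) (fib%2≡fibParity b) ⟩
  fibParity a ⊕ fibParity b        ∎

count : ℕ → List ℕ → ℕ
count k xs = length (filter (_≟ k) xs)

count-++ : ∀ k xs ys → count k (xs ++ ys) ≡ count k xs + count k ys
count-++ k xs ys = trans (cong length (filter-++ (_≟ k) xs ys)) (length-++ (filter (_≟ k) xs))

length-filter-map : ∀ {A : Set} k (f : A → ℕ) xs →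
                    length (filter (λ x → f x ≟ k) xs) ≡ count k (map f xs)
length-filter-map k f [] = refl
length-filter-map k f (x ∷ xs) with does (f x ≟ k)
... | true  = cong suc (length-filter-map k f xs)
... | false = length-filter-map k f xs

tabulate-toℕ : ∀ {A : Set} n (f : ℕ → A) → tabulate (f ∘ toℕ {n}) ≡ applyUpTo f n
tabulate-toℕ zero    f = refl
tabulate-toℕ (suc n) f = cong (f 0 ∷_) (tabulate-toℕ n (f ∘ suc))

applyUpTo-cong : ∀ {A : Set} {f g : ℕ → A} m →
                 (∀ {j} → j < m → f j ≡ g j) → applyUpTo f m ≡ applyUpTo g m
applyUpTo-cong zero    eq = refl
applyUpTo-cong (suc m) eq = cong₂ _∷_ (eq (s≤s z≤n)) (applyUpTo-cong m (eq ∘ s≤s))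

applyUpTo-+ : ∀ {A : Set} (f : ℕ → A) m n →
              applyUpTo f (m + n) ≡ applyUpTo f m ++ applyUpTo (f ∘ (m +_)) n
applyUpTo-+ f zero    n = refl
applyUpTo-+ f (suc m) n = cong (f 0 ∷_) (applyUpTo-+ (f ∘ suc) m n)

concat-applyUpTo-suc : ∀ {A : Set} (f : ℕ → List A) m →
                       concat (applyUpTo f (suc m)) ≡ concat (applyUpTo f m) ++ f m
concat-applyUpTo-suc f m = begin
  concat (applyUpTo f (suc m))              ≡⟨ cong concat (applyUpTo-∷ʳ f m) ⟨
  concat (applyUpTo f m ++ [ f m ])         ≡⟨ concat-++ (applyUpTo f m) [ f m ] ⟨
  concat (applyUpTo f m) ++ (f m ++ [])     ≡⟨ cong (concat (applyUpTo f m) ++_) (++-identityʳ (f m)) ⟩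
  concat (applyUpTo f m) ++ f m             ∎

module _ (p : ℕ) .{{_ : NonZero p}} where

  periodic-induction : {P : ℕ → Set} →
                       (∀ {r} → r < p → P r) → (∀ w → P w → P (p + w)) → ∀ w → P w
  periodic-induction {P} base step w = subst P (sym w≡) (blocks (w / p))
    where
    w≡ : w ≡ w / p * p + w % p
    w≡ = trans (m≡m%n+[m/n]*n w p) (+-comm (w % p) (w / p * p))
    blocks : ∀ q → P (q * p + w % p)
    blocks zero    = base (m%n<n w p)
    blocks (suc q) = subst P (sym (+-assoc p (q * p) (w % p))) (step (q * p + w % p) (blocks q))

  blockwise : (ℕ → ℕ) → ℕ → ℕ
  blockwise τ w = w / p * p + τ (w % p)

  blockwise-+ : ∀ τ w → blockwise τ (p + w) ≡ p + blockwise τ w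
  blockwise-+ τ w = begin
    (p + w) / p * p + τ ((p + w) % p)    ≡⟨ cong₂ (λ q r → q * p + τ r) quot rem ⟩
    suc (w / p) * p + τ (w % p)          ≡⟨ +-assoc p (w / p * p) (τ (w % p)) ⟩
    p + blockwise τ w                    ∎
    where
    quot : (p + w) / p ≡ suc (w / p)
    quot = trans (+-distrib-/-∣ˡ w ∣-refl) (cong (_+ w / p) (n/n≡1 p))
    rem : (p + w) % p ≡ w % p
    rem = trans (cong (_% p) (+-comm p w)) ([m+n]%n≡m%n w p)

rungEdges : ∀ {n} → Fin n → List (Fin (n + n) × Fin (n + n))
rungEdges {n} i = (i ↑ˡ n , next i ↑ˡ n) ∷ (i ↑ˡ n , n ↑ʳ i) ∷ (n ↑ʳ i , n ↑ʳ next i) ∷ []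

edges-GP1 : ∀ n → edges (GP1 n) ≡ concatMap rungEdges (allFin n)
edges-GP1 n = refl

toℕ-next : ∀ {m} (i : Fin (suc m)) → toℕ (next i) ≡ suc (toℕ i) % suc m
toℕ-next i = toℕ-fromℕ< _

module PrismLabels (u v : ℕ → ℕ) where

  rungLabels : ℕ → ℕ → List ℕ
  rungLabels j j′ = u j ⊕ u j′ ∷ u j ⊕ v j ∷ v j ⊕ v j′ ∷ []

  pathLabels : ℕ → List ℕ
  pathLabels m = concat (applyUpTo (λ j → rungLabels j (suc j)) m)

  -- the edge labels of GP(m + 1, 1) when u j and v j are the label parities of u_j and v_j
  cycleLabels : ℕ → List ℕ
  cycleLabels m = pathLabels m ++ rungLabels m 0

  module _ (p : ℕ) (u-periodic : ∀ j → u (p + j) ≡ u j)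
                   (v-periodic : ∀ j → v (p + j) ≡ v j) where

    rungLabels-periodicˡ : ∀ j j′ → rungLabels (p + j) j′ ≡ rungLabels j j′
    rungLabels-periodicˡ j j′ rewrite u-periodic j | v-periodic j = refl

    rungLabels-periodic : ∀ j → rungLabels (p + j) (suc (p + j)) ≡ rungLabels j (suc j)
    rungLabels-periodic j rewrite sym (+-suc p j) | u-periodic (suc j) | v-periodic (suc j) =
      rungLabels-periodicˡ j (suc j)

    cycleLabels-periodic : ∀ m → cycleLabels (p + m) ≡ pathLabels p ++ cycleLabels m
    cycleLabels-periodic m = begin
      concat (applyUpTo rung (p + m)) ++ rungLabels (p + m) 0
        ≡⟨ cong₂ (λ xs ys → concat xs ++ ys) (applyUpTo-+ rung p m) (rungLabels-periodicˡ m 0) ⟩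
      concat (applyUpTo rung p ++ shifted) ++ rungLabels m 0
        ≡⟨ cong (_++ rungLabels m 0) (concat-++ (applyUpTo rung p) shifted) ⟨
      (pathLabels p ++ concat shifted) ++ rungLabels m 0
        ≡⟨ ++-assoc (pathLabels p) (concat shifted) (rungLabels m 0) ⟩
      pathLabels p ++ concat shifted ++ rungLabels m 0
        ≡⟨ cong (λ xs → pathLabels p ++ concat xs ++ rungLabels m 0)
                (applyUpTo-cong m (λ {j} _ → rungLabels-periodic j)) ⟩
      pathLabels p ++ cycleLabels m
        ∎
      where
      rung : ℕ → List ℕ
      rung j = rungLabels j (suc j)
      shifted : List (List ℕ)
      shifted = applyUpTo (rung ∘ (p +_)) m

  edgeLabels-GP1 : ∀ {m} (f : Labeling (GP1 (suc m))) →
                   (∀ i → fibParity (toℕ (f (i ↑ˡ suc m))) ≡ u (toℕ i)) →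
                   (∀ i → fibParity (toℕ (f (suc m ↑ʳ i))) ≡ v (toℕ i)) →
                   map (edgeLabel (GP1 (suc m)) f) (edges (GP1 (suc m))) ≡ cycleLabels m
  edgeLabels-GP1 {m} f hu hv = begin
    map L (edges (GP1 n))                     ≡⟨ cong (map L) (edges-GP1 n) ⟩
    map L (concatMap rungEdges (allFin n))    ≡⟨ map-concatMap L rungEdges (allFin n) ⟩
    concatMap (map L ∘ rungEdges) (allFin n)  ≡⟨ concatMap-cong rung (allFin n) ⟩
    concat (map (R ∘ toℕ) (allFin n))         ≡⟨ cong concat (map-tabulate {n = n} id (R ∘ toℕ)) ⟩
    concat (tabulate {n = n} (R ∘ toℕ))       ≡⟨ cong concat (tabulate-toℕ n R) ⟩
    concat (applyUpTo R n)                    ≡⟨ concat-applyUpTo-suc R m ⟩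
    concat (applyUpTo R m) ++ R m             ≡⟨ cong₂ (λ xs j → concat xs ++ rungLabels m j)
                                                       (applyUpTo-cong m inner) (n%n≡0 n) ⟩
    cycleLabels m                             ∎
    where
    n = suc m
    L = edgeLabel (GP1 n) f
    R : ℕ → List ℕ
    R j = rungLabels j (suc j % n)
    inner : ∀ {j} → j < m → R j ≡ rungLabels j (suc j)
    inner j<m = cong (rungLabels _) (m<n⇒m%n≡m (s≤s j<m))
    edge : ∀ {a b x y} → fibParity (toℕ (f a)) ≡ x → fibParity (toℕ (f b)) ≡ y →
           L (a , b) ≡ x ⊕ y
    edge {a} {b} a≡x b≡y = trans (fib+fib%2 (toℕ (f a)) (toℕ (f b))) (cong₂ _⊕_ a≡x b≡y)
    rung : ∀ i → map L (rungEdges i) ≡ R (toℕ i)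
    rung i = cong₂ _∷_ (edge (hu i) u-next)
               (cong₂ _∷_ (edge (hu i) (hv i))
                 (cong [_] (edge (hv i) v-next)))
      where
      u-next = trans (hu (next i)) (cong u (toℕ-next i))
      v-next = trans (hv (next i)) (cong v (toℕ-next i))

transpose : ℕ → ℕ → ℕ → ℕ
transpose a b r = if r ≡ᵇ a then b else if r ≡ᵇ b then a else r

-- τ was found by a computer search; being an involution makes σ injective for free.
τ : ℕ → ℕ
τ = transpose 3 4 ∘ transpose 6 8 ∘ transpose 10 12 ∘ transpose 14 15 ∘ transpose 21 22

σ : ℕ → ℕ
σ = blockwise 24 τ

σ-+24 : ∀ w → σ (24 + w) ≡ 24 + σ w
σ-+24 = blockwise-+ 24 τ

σ-involutive : ∀ w → σ (σ w) ≡ w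
σ-involutive = periodic-induction 24 (from-yes (allUpTo? (λ w → σ (σ w) ≟ w) 24)) step
  where
  step : ∀ w → σ (σ w) ≡ w → σ (σ (24 + w)) ≡ 24 + w
  step w eq = begin
    σ (σ (24 + w))   ≡⟨ cong σ (σ-+24 w) ⟩
    σ (24 + σ w)     ≡⟨ σ-+24 (σ w) ⟩
    24 + σ (σ w)     ≡⟨ cong (24 +_) eq ⟩
    24 + w           ∎

σ-injective : Injective _≡_ _≡_ σ
σ-injective {x} {y} eq = trans (sym (σ-involutive x)) (trans (cong σ eq) (σ-involutive y))

RungBounded : ℕ → Set
RungBounded j = σ (j * 2) ≤ suc j * 2 × σ (suc (j * 2)) ≤ suc j * 2

rungBounded : ∀ j → RungBounded j
rungBounded = periodic-induction 12 {RungBounded} (from-yes (allUpTo? rungBounded? 12)) step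
  where
  rungBounded? : ∀ j → Dec (RungBounded j)
  rungBounded? j = (σ (j * 2) ≤? suc j * 2) ×-dec (σ (suc (j * 2)) ≤? suc j * 2)
  step : ∀ j → RungBounded j → RungBounded (12 + j)
  step j (u≤ , v≤) = ≤-trans (≤-reflexive (σ-+24 (j * 2))) (+-monoʳ-≤ 24 u≤)
                     , ≤-trans (≤-reflexive (σ-+24 (suc (j * 2)))) (+-monoʳ-≤ 24 v≤)

vertexCode : ∀ {n} → Fin n ⊎ Fin n → ℕ
vertexCode (inj₁ i) = toℕ i * 2
vertexCode (inj₂ i) = suc (toℕ i * 2)

m*2≢1+n*2 : ∀ m n → m * 2 ≢ suc (n * 2)
m*2≢1+n*2 m n eq = even≢odd m n (subst₂ (λ a b → a ≡ suc b) (*-comm m 2) (*-comm n 2) eq)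

vertexCode-injective : ∀ {n} → Injective _≡_ _≡_ (vertexCode {n})
vertexCode-injective {x = inj₁ i} {inj₁ j} eq =
  cong inj₁ (toℕ-injective (*-cancelʳ-≡ (toℕ i) (toℕ j) 2 eq))
vertexCode-injective {x = inj₂ i} {inj₂ j} eq =
  cong inj₂ (toℕ-injective (*-cancelʳ-≡ (toℕ i) (toℕ j) 2 (suc-injective eq)))
vertexCode-injective {x = inj₁ i} {inj₂ j} eq = ⊥-elim (m*2≢1+n*2 (toℕ i) (toℕ j) eq)
vertexCode-injective {x = inj₂ i} {inj₁ j} eq = ⊥-elim (m*2≢1+n*2 (toℕ j) (toℕ i) (sym eq))

m<n⇒[1+m]*2≤n+n : ∀ {m n} → m < n → suc m * 2 ≤ n + n
m<n⇒[1+m]*2≤n+n {n = n} m<n =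
  ≤-trans (*-monoˡ-≤ 2 m<n) (≤-reflexive (trans (*-comm n 2) (cong (n +_) (+-identityʳ n))))

σ-vertexCode< : ∀ {n} (x : Fin n ⊎ Fin n) → σ (vertexCode x) < suc (n + n)
σ-vertexCode< (inj₁ i) = s≤s (≤-trans (proj₁ (rungBounded (toℕ i))) (m<n⇒[1+m]*2≤n+n (toℕ<n i)))
σ-vertexCode< (inj₂ i) = s≤s (≤-trans (proj₂ (rungBounded (toℕ i))) (m<n⇒[1+m]*2≤n+n (toℕ<n i)))

label : (n : ℕ) → Labeling (GP1 n)
label n x = fromℕ< (σ-vertexCode< (splitAt n x))

label-injective : ∀ n → Injective _≡_ _≡_ (label n)
label-injective n {x} {y} eq = begin
  x                        ≡⟨ join-splitAt n n x ⟨
  join n n (splitAt n x)   ≡⟨ cong (join n n) splits≡ ⟩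
  join n n (splitAt n y)   ≡⟨ join-splitAt n n y ⟩
  y                        ∎
  where
  codes≡ : σ (vertexCode (splitAt n x)) ≡ σ (vertexCode (splitAt n y))
  codes≡ = trans (sym (toℕ-fromℕ< _)) (trans (cong toℕ eq) (toℕ-fromℕ< _))
  splits≡ : splitAt n x ≡ splitAt n y
  splits≡ = vertexCode-injective {x = splitAt n x} {splitAt n y} (σ-injective codes≡)

toℕ-label-↑ˡ : ∀ n i → toℕ (label n (i ↑ˡ n)) ≡ σ (toℕ i * 2)
toℕ-label-↑ˡ n i rewrite splitAt-↑ˡ n i n = toℕ-fromℕ< _

toℕ-label-↑ʳ : ∀ n i → toℕ (label n (n ↑ʳ i)) ≡ σ (suc (toℕ i * 2))
toℕ-label-↑ʳ n i rewrite splitAt-↑ʳ n n i = toℕ-fromℕ< _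

uParity vParity : ℕ → ℕ
uParity j = fibParity (σ (j * 2))
vParity j = fibParity (σ (suc (j * 2)))

open PrismLabels uParity vParity

cycleLabels-+12 : ∀ m → cycleLabels (12 + m) ≡ pathLabels 12 ++ cycleLabels m
cycleLabels-+12 =
  cycleLabels-periodic 12 (cong fibParity ∘ σ-+24 ∘ (_* 2)) (cong fibParity ∘ σ-+24 ∘ suc ∘ (_* 2))

ε-label : ∀ m k → ε (GP1 (suc m)) (label (suc m)) k ≡ count k (cycleLabels m)
ε-label m k = begin
  ε G f k                                  ≡⟨ length-filter-map k (edgeLabel G f) (edges G) ⟩
  count k (map (edgeLabel G f) (edges G))  ≡⟨ cong (count k) (edgeLabels-GP1 f u-parity v-parity) ⟩
  count k (cycleLabels m)                  ∎
  where
  G = GP1 (suc m)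
  f = label (suc m)
  u-parity : ∀ i → fibParity (toℕ (f (i ↑ˡ suc m))) ≡ uParity (toℕ i)
  u-parity = cong fibParity ∘ toℕ-label-↑ˡ (suc m)
  v-parity : ∀ i → fibParity (toℕ (f (suc m ↑ʳ i))) ≡ vParity (toℕ i)
  v-parity = cong fibParity ∘ toℕ-label-↑ʳ (suc m)

balanced? : ∀ a b → Dec (Balanced a b)
balanced? a b = (a ∸ b ≤? 1) ×-dec (b ∸ a ≤? 1)

Balanced-+ : ∀ c a b → Balanced a b → Balanced (c + a) (c + b)
Balanced-+ c a b (a∸b≤1 , b∸a≤1) =
  subst (_≤ 1) (sym ([m+n]∸[m+o]≡n∸o c a b)) a∸b≤1 ,
  subst (_≤ 1) (sym ([m+n]∸[m+o]≡n∸o c b a)) b∸a≤1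

BalancedCycle : ℕ → Set
BalancedCycle m = Balanced (count 0 (cycleLabels m)) (count 1 (cycleLabels m))

balancedCycle : ∀ m → BalancedCycle (2 + m)
balancedCycle =
  periodic-induction 12 {BalancedCycle ∘ (2 +_)} (from-yes (allUpTo? balancedCycle? 12)) step
  where
  balancedCycle? : ∀ m → Dec (BalancedCycle (2 + m))
  balancedCycle? m = balanced? (count 0 (cycleLabels (2 + m))) (count 1 (cycleLabels (2 + m)))
  count-+12 : ∀ k m → count k (pathLabels 12) ≡ 18 →
              count k (cycleLabels (12 + m)) ≡ 18 + count k (cycleLabels m)
  count-+12 k m path≡18 = begin
    count k (cycleLabels (12 + m))                       ≡⟨ cong (count k) (cycleLabels-+12 m) ⟩
    count k (pathLabels 12 ++ cycleLabels m)             ≡⟨ count-++ k (pathLabels 12) (cycleLabels m) ⟩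
    count k (pathLabels 12) + count k (cycleLabels m)    ≡⟨ cong (_+ count k (cycleLabels m)) path≡18 ⟩
    18 + count k (cycleLabels m)                         ∎
  step : ∀ m → BalancedCycle (2 + m) → BalancedCycle (2 + (12 + m))
  step m bal = subst₂ Balanced (sym (count-+12 0 (2 + m) refl)) (sym (count-+12 1 (2 + m) refl))
    (Balanced-+ 18 (count 0 (cycleLabels (2 + m))) (count 1 (cycleLabels (2 + m))) bal)

mainTheorem1 : (n : ℕ) → n ≥ 3 → FibonacciCordial (GP1 n)
mainTheorem1 (suc (suc (suc m))) (s≤s (s≤s (s≤s z≤n))) =
  label (3 + m) , label-injective (3 + m) ,
  subst₂ Balanced (sym (ε-label (2 + m) 0)) (sym (ε-label (2 + m) 1)) (balancedCycle m)
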